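{- Let $G$ be a finite transitive permutation group whose point stabilizers have order $2$ or $3$. Then the complement $\overline{\Gamma_G}$ of the derangement graph of $G$ is arc-transitive.
   Context: For $G\le\mathrm{Sym}(V)$, a derangement is an element fixing no point of $V$; with $\mathcal{D}$ the set of derangements, the derangement graph $\Gamma_G$ has vertex set $G$ with $g,h$ adjacent iff $g^{ -1}h\in\mathcal{D}$. Its complement $\overline{\Gamma_G}$ is the Cayley graph on $G$ whose connection set is the set of non-identity elements of $G$ that fix at least one point. -}

module Defs where

open import Data.Nat using (ℕ)
open import Data.Fin using (Fin)
open import Data.Vec using (Vec; lookup)
open import Data.Product using (Σ; ∃; _×_; proj₁)
open import Relation.Nullary using (¬_)
open import Relation.Binary.PropositionalEquality using (_≡_; _≢_)
open import Function using (_∘_; id)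

-- Maps on the point set V = Fin n; permutations are those with inverses.
Fun : ℕ → Set
Fun n = Fin n → Fin n

_≈_ : ∀ {n} → Fun n → Fun n → Set
f ≈ g = ∀ x → f x ≡ g x

infix 4 _≈_

-- G ≤ Sym(Fin n), given as a subset of maps closed under the group
-- operations (and under pointwise equality). Automatically finite.
record IsPermGroup (n : ℕ) (G : Fun n → Set) : Set where
  field
    resp  : ∀ {f g} → f ≈ g → G f → G g
    id∈   : G id
    comp∈ : ∀ {f g} → G f → G g → G (f ∘ g)
    inv∈  : ∀ {f} → G f → Σ (Fun n) λ h → G h × (h ∘ f ≈ id) × (f ∘ h ≈ id)

IsTransitive : ∀ {n} → (Fun n → Set) → Set
IsTransitive {n} G = ∀ (x y : Fin n) → Σ (Fun n) λ g → G g × (g x ≡ y)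

Stab : ∀ {n} → (Fun n → Set) → Fin n → Fun n → Set
Stab G x f = G f × (f x ≡ x)

HasOrder : ∀ {n} → (Fun n → Set) → ℕ → Set
HasOrder {n} P k =
  Σ (Vec (Fun n) k) λ v →
    (∀ i → P (lookup v i)) ×
    (∀ i j → i ≢ j → ¬ (lookup v i ≈ lookup v j)) ×
    (∀ f → P f → ∃ λ i → f ≈ lookup v i)

-- Elements of G (vertices of the derangement graph and its complement).
Elt : ∀ {n} → (Fun n → Set) → Set
Elt {n} G = Σ (Fun n) G

_≈ᴱ_ : ∀ {n} {G : Fun n → Set} → Elt G → Elt G → Set
a ≈ᴱ b = proj₁ a ≈ proj₁ b

infix 4 _≈ᴱ_

-- Connection set of the complement: non-identity elements of G fixing a point.
ConnSet : ∀ {n} → (Fun n → Set) → Fun n → Set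
ConnSet {n} G c = G c × (∃ λ (x : Fin n) → c x ≡ x) × ¬ (c ≈ id)

-- Adjacency in the complement of the derangement graph (Cayley graph
-- Cay(G, ConnSet)): g ~ h iff g⁻¹h ∈ ConnSet, i.e. h = g ∘ c with c ∈ ConnSet.
ComplAdj : ∀ {n} (G : Fun n → Set) → Elt G → Elt G → Set
ComplAdj {n} G a b = Σ (Fun n) λ c → ConnSet G c × (proj₁ a ∘ c ≈ proj₁ b)

record Automorphism {n} (G : Fun n → Set) : Set where
  field
    φ      : Elt G → Elt G
    ψ      : Elt G → Elt G
    φ-resp : ∀ {a b} → a ≈ᴱ b → φ a ≈ᴱ φ b
    ψ-resp : ∀ {a b} → a ≈ᴱ b → ψ a ≈ᴱ ψ b
    ψφ     : ∀ a → ψ (φ a) ≈ᴱ a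
    φψ     : ∀ a → φ (ψ a) ≈ᴱ a
    pres   : ∀ a b → ComplAdj G a b → ComplAdj G (φ a) (φ b)
    refl'  : ∀ a b → ComplAdj G (φ a) (φ b) → ComplAdj G a b

ArcTransitive : ∀ {n} (G : Fun n → Set) → Set
ArcTransitive G =
  ∀ a b a' b' → ComplAdj G a b → ComplAdj G a' b' →
    Σ (Automorphism G) λ σ →
      (Automorphism.φ σ a ≈ᴱ a') × (Automorphism.φ σ b ≈ᴱ b')

-- The complement of the derangement graph is the Cayley graph Cay(G, S) with S the union of
-- the sets G_x ∖ {1}. Left translations are automorphisms acting transitively on vertices, so
-- it suffices to send the arc (1, c) to (1, c') by an automorphism fixing 1, for all c, c' ∈ S.
-- Say c ∈ G_x, c' ∈ G_y and g x = y; then h = g c g⁻¹ ∈ G_y ∖ {1}. Since |G_y| ≤ 3, c' is h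
-- or h⁻¹, for otherwise 1, h, c', h c' are four distinct elements of G_y. Conjugation by g sends
-- (1, c) to (1, h), and following it by inversion, an automorphism because S is closed under
-- conjugation and inverses, sends (1, c) to (1, h⁻¹).
module Submission where

open import Defs
open import Data.Empty using (⊥-elim)
open import Data.Fin using (Fin; zero; suc; _≟_)
open import Data.Fin.Properties using (all?; injective⇒≤)
open import Data.Nat using (ℕ; _≤_; z≤n; s≤s)
open import Data.Nat.Properties using (≤-refl; <⇒≱)
open import Data.Product using (Σ; ∃; _×_; _,_; proj₁; proj₂)
open import Data.Sum using (_⊎_; inj₁; inj₂)
open import Data.Vec using (lookup)
open import Data.Vec.Functional using (Vector; []; _∷_)
open import Function using (_∘_; id)
open import Function.Definitions using (Injective)
open import Relation.Binary using (Setoid)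
open import Relation.Binary.PropositionalEquality
  using (_≡_; refl; sym; trans; cong; _→-setoid_; module ≡-Reasoning)
open import Relation.Nullary using (¬_; Dec; yes; no)

open Automorphism using (φ; φ-resp)

private
  module ≈ {n : ℕ} = Setoid (Fin n →-setoid Fin n)

module _ {n : ℕ} where

  infix 4 _≈?_

  _≈?_ : (f g : Fun n) → Dec (f ≈ g)
  f ≈? g = all? λ x → f x ≟ g x

  []-injective : Injective _≡_ _≈_ ([] {A = Fun n})
  []-injective {()}

  ∷-injective : ∀ {m f} {u : Vector (Fun n) m} → (∀ i → ¬ f ≈ u i) →
    Injective _≡_ _≈_ u → Injective _≡_ _≈_ (f ∷ u)
  ∷-injective _   _           {zero}  {zero}  _   = refl
  ∷-injective f≉u _           {zero}  {suc j} f≈u = ⊥-elim (f≉u j f≈u)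
  ∷-injective f≉u _           {suc i} {zero}  u≈f = ⊥-elim (f≉u i (≈.sym u≈f))
  ∷-injective _   u-injective {suc i} {suc j} u≈u = cong suc (u-injective u≈u)

  injective⇒≤order : ∀ {P : Fun n → Set} {k m} {u : Vector (Fun n) m} →
    HasOrder P k → (∀ i → P (u i)) → Injective _≡_ _≈_ u → m ≤ k
  injective⇒≤order {u = u} (v , _ , _ , cover) u∈P u-injective =
    injective⇒≤ index-injective
    where
      index-injective : Injective _≡_ _≡_ (λ i → proj₁ (cover (u i) (u∈P i)))
      index-injective {i} {j} eq = u-injective
        (≈.trans (proj₂ (cover (u i) (u∈P i)))
        (≈.trans (≈.reflexive (cong (lookup v) eq))
                 (≈.sym (proj₂ (cover (u j) (u∈P j))))))

  order-2-or-3⇒≤3 : ∀ {P : Fun n → Set} → HasOrder P 2 ⊎ HasOrder P 3 →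
    ∃ λ k → HasOrder P k × k ≤ 3
  order-2-or-3⇒≤3 (inj₁ order2) = 2 , order2 , s≤s (s≤s z≤n)
  order-2-or-3⇒≤3 (inj₂ order3) = 3 , order3 , ≤-refl

module _ {n : ℕ} {G : Fun n → Set} (PG : IsPermGroup n G) where

  open IsPermGroup PG

  infix 10 _⁻¹

  _⁻¹ : ∀ {f} → G f → Fun n
  p ⁻¹ = proj₁ (inv∈ p)

  ⁻¹∈ : ∀ {f} (p : G f) → G (p ⁻¹)
  ⁻¹∈ p = proj₁ (proj₂ (inv∈ p))

  inverseˡ : ∀ {f} (p : G f) → p ⁻¹ ∘ f ≈ id
  inverseˡ p = proj₁ (proj₂ (proj₂ (inv∈ p)))

  inverseʳ : ∀ {f} (p : G f) → f ∘ p ⁻¹ ≈ id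
  inverseʳ p = proj₂ (proj₂ (proj₂ (inv∈ p)))

  cancelˡ : ∀ {f g h} (p : G f) → f ∘ g ≈ f ∘ h → g ≈ h
  cancelˡ {g = g} {h} p f∘g≈f∘h x =
    trans (sym (inverseˡ p (g x))) (trans (cong (p ⁻¹) (f∘g≈f∘h x)) (inverseˡ p (h x)))

  cancelʳ : ∀ {f g h} (p : G f) → g ∘ f ≈ h ∘ f → g ≈ h
  cancelʳ {g = g} {h} p g∘f≈h∘f x =
    trans (cong g (sym (inverseʳ p x))) (trans (g∘f≈h∘f ((p ⁻¹) x)) (cong h (inverseʳ p x)))

  inverse-unique : ∀ {f g} (p : G f) → f ∘ g ≈ id → g ≈ p ⁻¹
  inverse-unique {g = g} p f∘g≈id =
    cancelˡ {g = g} {p ⁻¹} p (≈.trans f∘g≈id (≈.sym (inverseʳ p)))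

  ⁻¹-cong : ∀ {f g} (p : G f) (q : G g) → f ≈ g → p ⁻¹ ≈ q ⁻¹
  ⁻¹-cong p q f≈g = inverse-unique q λ x → trans (sym (f≈g ((p ⁻¹) x))) (inverseʳ p x)

  ⁻¹-involutive : ∀ {f} (p : G f) → ⁻¹∈ p ⁻¹ ≈ f
  ⁻¹-involutive p = ≈.sym (inverse-unique (⁻¹∈ p) (inverseˡ p))

  ⁻¹-identity : id∈ ⁻¹ ≈ id
  ⁻¹-identity = ≈.sym (inverse-unique id∈ ≈.refl)

  conjugate-≉id : ∀ {g c : Fun n} (p : G g) → ¬ c ≈ id → ¬ g ∘ c ∘ p ⁻¹ ≈ id
  conjugate-≉id {c = c} p c≉id conj≈id =
    c≉id (cancelʳ {g = c} {id} (⁻¹∈ p)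
           (cancelˡ {g = c ∘ p ⁻¹} {p ⁻¹} p (≈.trans conj≈id (≈.sym (inverseʳ p)))))

  conjugate-∈Stab : ∀ {g c x y} (p : G g) → G c → c x ≡ x → g x ≡ y →
    Stab G y (g ∘ c ∘ p ⁻¹)
  conjugate-∈Stab {g} {c} p c∈G cx≡x gx≡y =
    comp∈ p (comp∈ c∈G (⁻¹∈ p)) ,
    trans (cong (g ∘ c) (trans (cong (p ⁻¹) (sym gx≡y)) (inverseˡ p _)))
          (trans (cong g cx≡x) gx≡y)

  conjugate-∈ConnSet : ∀ {g c} (p : G g) → ConnSet G c → ConnSet G (g ∘ c ∘ p ⁻¹)
  conjugate-∈ConnSet {g} p (c∈G , (x , cx≡x) , c≉id) =
    proj₁ c∈Stab , (g x , proj₂ c∈Stab) , conjugate-≉id p c≉id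
    where c∈Stab = conjugate-∈Stab p c∈G cx≡x refl

  ⁻¹-∈ConnSet : ∀ {c} (p : G c) → ConnSet G c → ConnSet G (p ⁻¹)
  ⁻¹-∈ConnSet {c} p (_ , (x , cx≡x) , c≉id) =
    ⁻¹∈ p ,
    (x , trans (cong (p ⁻¹) (sym cx≡x)) (inverseˡ p x)) ,
    λ c⁻¹≈id → c≉id λ z → trans (cong c (sym (c⁻¹≈id z))) (inverseʳ p z)

  order≤3⇒nonidentity-≈⊎≈⁻¹ : ∀ {y k h c} → HasOrder (Stab G y) k → k ≤ 3 →
    (h∈Stab : Stab G y h) → Stab G y c → ¬ h ≈ id → ¬ c ≈ id →
    c ≈ h ⊎ c ≈ proj₁ h∈Stab ⁻¹
  order≤3⇒nonidentity-≈⊎≈⁻¹ {y} {_} {h} {c} order k≤3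
    h∈Stab@(h∈G , hy≡y) c∈Stab@(c∈G , cy≡y) h≉id c≉id
    with c ≈? h | c ≈? h∈G ⁻¹
  ... | yes c≈h | _         = inj₁ c≈h
  ... | no _    | yes c≈h⁻¹ = inj₂ c≈h⁻¹
  ... | no c≉h  | no c≉h⁻¹  =
    ⊥-elim (<⇒≱ (s≤s k≤3) (injective⇒≤order order members distinct))
    where
      members : ∀ i → Stab G y ((id ∷ h ∷ c ∷ (h ∘ c) ∷ []) i)
      members zero                   = id∈ , refl
      members (suc zero)             = h∈Stab
      members (suc (suc zero))       = c∈Stab
      members (suc (suc (suc zero))) = comp∈ h∈G c∈G , trans (cong h cy≡y) hy≡y

      distinct : Injective _≡_ _≈_ (id ∷ h ∷ c ∷ (h ∘ c) ∷ [])
      distinct =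
        ∷-injective
          (λ { zero → h≉id ∘ ≈.sym
             ; (suc zero) → c≉id ∘ ≈.sym
             ; (suc (suc zero)) → λ id≈hc → c≉h⁻¹ (inverse-unique h∈G (≈.sym id≈hc)) })
        (∷-injective
          (λ { zero → c≉h ∘ ≈.sym
             ; (suc zero) → λ h≈hc → c≉id (≈.sym (cancelˡ {g = id} {c} h∈G h≈hc)) })
        (∷-injective
          (λ { zero → λ c≈hc → h≉id (≈.sym (cancelʳ {g = id} {h} c∈G c≈hc)) })
        (∷-injective (λ ()) []-injective)))

  adjacent-resp : ∀ {a b a' b'} → a ≈ᴱ a' → b ≈ᴱ b' → ComplAdj G a b → ComplAdj G a' b'
  adjacent-resp a≈a' b≈b' (c , c∈S , a∘c≈b) =
    c , c∈S , λ x → trans (sym (a≈a' (c x))) (trans (a∘c≈b x) (b≈b' x))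

  automorphism : (f g : Elt G → Elt G) →
    (∀ {a b} → a ≈ᴱ b → f a ≈ᴱ f b) → (∀ {a b} → a ≈ᴱ b → g a ≈ᴱ g b) →
    (∀ a → g (f a) ≈ᴱ a) → (∀ a → f (g a) ≈ᴱ a) →
    (∀ a b → ComplAdj G a b → ComplAdj G (f a) (f b)) →
    (∀ a b → ComplAdj G a b → ComplAdj G (g a) (g b)) → Automorphism G
  automorphism f g f-cong g-cong g∘f≈id f∘g≈id f-adj g-adj = record
    { φ = f ; ψ = g ; φ-resp = f-cong ; ψ-resp = g-cong ; ψφ = g∘f≈id ; φψ = f∘g≈id
    ; pres = f-adj
    ; refl' = λ a b fa~fb →
        adjacent-resp {g (f a)} {g (f b)} {a} {b} (g∘f≈id a) (g∘f≈id b)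
          (g-adj (f a) (f b) fa~fb) }

  infixr 9 _⊚_

  _⊚_ : Automorphism G → Automorphism G → Automorphism G
  σ ⊚ τ = record
    { φ = σ.φ ∘ τ.φ ; ψ = τ.ψ ∘ σ.ψ
    ; φ-resp = σ.φ-resp ∘ τ.φ-resp ; ψ-resp = τ.ψ-resp ∘ σ.ψ-resp
    ; ψφ = λ a → ≈.trans (τ.ψ-resp (σ.ψφ (τ.φ a))) (τ.ψφ a)
    ; φψ = λ a → ≈.trans (σ.φ-resp (τ.φψ (σ.ψ a))) (σ.φψ a)
    ; pres = λ a b → σ.pres (τ.φ a) (τ.φ b) ∘ τ.pres a b
    ; refl' = λ a b → τ.refl' a b ∘ σ.refl' (τ.φ a) (τ.φ b) }
    where
      module σ = Automorphism σ
      module τ = Automorphism τ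

  1ᴱ : Elt G
  1ᴱ = id , id∈

  translateᴱ : ∀ {g} → G g → Elt G → Elt G
  translateᴱ {g} p (a , a∈G) = g ∘ a , comp∈ p a∈G

  conjugateᴱ : ∀ {g} → G g → Elt G → Elt G
  conjugateᴱ {g} p (a , a∈G) = g ∘ a ∘ p ⁻¹ , comp∈ p (comp∈ a∈G (⁻¹∈ p))

  invertᴱ : Elt G → Elt G
  invertᴱ (a , a∈G) = a∈G ⁻¹ , ⁻¹∈ a∈G

  translation : ∀ {g} → G g → Automorphism G
  translation {g} p = automorphism (translateᴱ p) (translateᴱ (⁻¹∈ p))
    (λ a≈b x → cong g (a≈b x)) (λ a≈b x → cong (p ⁻¹) (a≈b x))
    (λ a x → inverseˡ p (proj₁ a x)) (λ a x → inverseʳ p (proj₁ a x))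
    (translate-adjacent p) (translate-adjacent (⁻¹∈ p))
    where
      translate-adjacent : ∀ {f} (q : G f) a b → ComplAdj G a b →
        ComplAdj G (translateᴱ q a) (translateᴱ q b)
      translate-adjacent {f} _ _ _ (c , c∈S , a∘c≈b) = c , c∈S , λ x → cong f (a∘c≈b x)

  conjugation : ∀ {g} → G g → Automorphism G
  conjugation {g} p = automorphism (conjugateᴱ p) (conjugateᴱ (⁻¹∈ p))
    (λ a≈b x → cong g (a≈b ((p ⁻¹) x))) (λ a≈b x → cong (p ⁻¹) (a≈b ((⁻¹∈ p ⁻¹) x)))
    (λ (a , _) x → trans (inverseˡ p _) (cong a (inverseʳ (⁻¹∈ p) x)))
    (λ (a , _) x → trans (inverseʳ p _) (cong a (inverseˡ (⁻¹∈ p) x)))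
    (conjugate-adjacent p) (conjugate-adjacent (⁻¹∈ p))
    where
      conjugate-adjacent : ∀ {f} (q : G f) a b → ComplAdj G a b →
        ComplAdj G (conjugateᴱ q a) (conjugateᴱ q b)
      conjugate-adjacent {f} q (a , _) _ (c , c∈S , a∘c≈b) =
        f ∘ c ∘ q ⁻¹ , conjugate-∈ConnSet q c∈S ,
        λ x → cong f (trans (cong a (inverseˡ q _)) (a∘c≈b ((q ⁻¹) x)))

  inversion : Automorphism G
  inversion = automorphism invertᴱ invertᴱ invert-cong invert-cong
    (λ (_ , a∈G) → ⁻¹-involutive a∈G) (λ (_ , a∈G) → ⁻¹-involutive a∈G)
    invert-adjacent invert-adjacent
    where
      invert-cong : ∀ {a b} → a ≈ᴱ b → invertᴱ a ≈ᴱ invertᴱ b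
      invert-cong {_ , a∈G} {_ , b∈G} = ⁻¹-cong a∈G b∈G

      -- b⁻¹ = (a c)⁻¹ = a⁻¹ (a c⁻¹ a⁻¹)
      invert-adjacent : ∀ a b → ComplAdj G a b → ComplAdj G (invertᴱ a) (invertᴱ b)
      invert-adjacent (a , a∈G) (b , b∈G) (c , c∈S@(c∈G , _) , a∘c≈b) =
        a ∘ c∈G ⁻¹ ∘ a∈G ⁻¹ , conjugate-∈ConnSet a∈G (⁻¹-∈ConnSet c∈G c∈S) ,
        λ x → trans (inverseˡ a∈G _) (inverse-unique b∈G b∘c⁻¹∘a⁻¹≈id x)
        where
          open ≡-Reasoning
          b∘c⁻¹∘a⁻¹≈id : b ∘ c∈G ⁻¹ ∘ a∈G ⁻¹ ≈ id
          b∘c⁻¹∘a⁻¹≈id x = begin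
            b ((c∈G ⁻¹) ((a∈G ⁻¹) x))      ≡⟨ sym (a∘c≈b _) ⟩
            a (c ((c∈G ⁻¹) ((a∈G ⁻¹) x)))  ≡⟨ cong a (inverseʳ c∈G _) ⟩
            a ((a∈G ⁻¹) x)                 ≡⟨ inverseʳ a∈G x ⟩
            x                              ∎

  ArcTransitiveAtIdentity : Set
  ArcTransitiveAtIdentity = ∀ {c c'} (s : ConnSet G c) (s' : ConnSet G c') →
    Σ (Automorphism G) λ σ → φ σ 1ᴱ ≈ᴱ 1ᴱ × φ σ (c , proj₁ s) ≈ᴱ (c' , proj₁ s')

  arcTransitiveAtIdentity⇒arcTransitive : ArcTransitiveAtIdentity → ArcTransitive G
  arcTransitiveAtIdentity⇒arcTransitive at-identity
    (a , a∈G) (b , _) (a' , a'∈G) _ (c , s , a∘c≈b) (c' , s' , a'∘c'≈b')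
    with σ , σ1≈1 , σc≈c' ← at-identity s s' =
    translation a'∈G ⊚ σ ⊚ translation (⁻¹∈ a∈G) ,
    (λ x → cong a' (trans (φ-resp σ (inverseˡ a∈G) x) (σ1≈1 x))) ,
    (λ x → trans (cong a' (trans (φ-resp σ a⁻¹∘b≈c x) (σc≈c' x))) (a'∘c'≈b' x))
    where
      a⁻¹∘b≈c : a∈G ⁻¹ ∘ b ≈ c
      a⁻¹∘b≈c x = trans (cong (a∈G ⁻¹) (sym (a∘c≈b x))) (inverseˡ a∈G (c x))

  transitive⇒arcTransitiveAtIdentity : IsTransitive G →
    (∀ x → HasOrder (Stab G x) 2 ⊎ HasOrder (Stab G x) 3) → ArcTransitiveAtIdentity
  transitive⇒arcTransitiveAtIdentity transitive order
    (c∈G , (x , cx≡x) , c≉id) (c'∈G , (y , c'y≡y) , c'≉id)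
    with g , g∈G , gx≡y ← transitive x y
    with k , order-k , k≤3 ← order-2-or-3⇒≤3 (order y)
    with order≤3⇒nonidentity-≈⊎≈⁻¹ order-k k≤3 (conjugate-∈Stab g∈G c∈G cx≡x gx≡y)
           (c'∈G , c'y≡y) (conjugate-≉id g∈G c≉id) c'≉id
  ... | inj₁ c'≈gcg⁻¹ = conjugation g∈G , inverseʳ g∈G , ≈.sym c'≈gcg⁻¹
  ... | inj₂ c'≈gc⁻¹g⁻¹ =
    inversion ⊚ conjugation g∈G ,
    ≈.trans (⁻¹-cong _ id∈ (inverseʳ g∈G)) ⁻¹-identity , ≈.sym c'≈gc⁻¹g⁻¹

lemma2p4 : (n : ℕ) (G : Fun n → Set) → IsPermGroup n G → IsTransitive G →
    (∀ (x : Fin n) → HasOrder (Stab G x) 2 ⊎ HasOrder (Stab G x) 3) →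
    ArcTransitive G
lemma2p4 n G PG transitive order =
  arcTransitiveAtIdentity⇒arcTransitive PG
    (transitive⇒arcTransitiveAtIdentity PG transitive order)
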